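{- Let $n\ge 27$, $j\in\{1,\dots,n-12\}$ and $k\in\{1,2\}$. If $S$ is a packing set of $T^{5k}(n)$ and two of the numbers $|S^{5k}_j(n)|$, $|S^{5k}_{j+1}(n)|$, $|S^{5k}_{j+2}(n)|$ are equal to $k$, then the remaining one is at most $k$.
   Context: $T(n)$ is the subgraph of the infinite integer grid (vertex set $\mathbb{Z}^2$, $(x,y)\sim(x',y')$ iff $|x-x'|+|y-y'|=1$) induced by $\{(x,y): 1\le x\le y\le n\}$. For a positive integer $\ell\le n$, $T^{\ell}(n)$ is the subgraph of $T(n)$ induced by the vertices $(x,y)$ of $T(n)$ with $n-\ell+1\le y\le n$. For a set $S$ and $1\le a\le n$, $S^{\ell}_a(n)=S\cap\{(a,y)\in V(T(n)): n-\ell+1\le y\le n\}$. A packing set of a graph $G$ is a set $S\subseteq V(G)$ such that any two distinct $u,v\in S$ satisfy $d_G(u,v)\ge 3$ ($d_G$ the distance in $G$). -}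

module Defs where

open import Data.Nat using (ℕ; zero; suc; _+_; _∸_; _≤_; ∣_-_∣; _≟_)
open import Data.Product using (_×_; _,_; proj₁; proj₂)
open import Data.List using (List; filter; length)
open import Data.List.Membership.Propositional using (_∈_)
open import Data.List.Relation.Unary.Unique.Propositional using (Unique)
open import Relation.Binary.PropositionalEquality using (_≡_)
open import Relation.Nullary.Decidable using (_×-dec_)
open import Data.Nat.Properties using (_≤?_)

-- Vertices of the integer grid (only the positive quadrant is ever used,
-- since all vertices of T(n) have 1 ≤ x ≤ y ≤ n).
Vertex : Set
Vertex = ℕ × ℕ

GridAdj : Vertex → Vertex → Set
GridAdj (x , y) (x' , y') = ∣ x - x' ∣ + ∣ y - y' ∣ ≡ 1

InTl : ℕ → ℕ → Vertex → Set
InTl ℓ n (x , y) = (1 ≤ x) × (x ≤ y) × (y ≤ n) × (n ∸ ℓ + 1 ≤ y)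

data Walk (ℓ n : ℕ) : ℕ → Vertex → Vertex → Set where
  here : ∀ {u} → InTl ℓ n u → Walk ℓ n 0 u u
  step : ∀ {k u w v} → InTl ℓ n u → GridAdj u w → Walk ℓ n k w v →
         Walk ℓ n (suc k) u v

-- d_{T^ℓ(n)}(u,v) ≥ 3 : every walk (hence every path) from u to v has length ≥ 3
-- (also true when u,v are disconnected, i.e. distance ∞).
DistGe3 : ℕ → ℕ → Vertex → Vertex → Set
DistGe3 ℓ n u v = ∀ k → Walk ℓ n k u v → 3 ≤ k

IsPackingSet : ℕ → ℕ → List Vertex → Set
IsPackingSet ℓ n S =
  Unique S × (∀ {u} → u ∈ S → InTl ℓ n u) ×
  (∀ {u v} → u ∈ S → v ∈ S → u ≢ v → DistGe3 ℓ n u v)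
  where
  open import Relation.Binary.PropositionalEquality using (_≢_)

-- S^ℓ_a(n) = S ∩ {(a,y) ∈ V(T(n)) : n-ℓ+1 ≤ y ≤ n}
column : ℕ → ℕ → ℕ → List Vertex → List Vertex
column ℓ n a S = filter (λ v → (proj₁ v ≟ a) ×-dec ((1 ≤? proj₁ v) ×-dec ((proj₁ v ≤? proj₂ v)
                   ×-dec ((proj₂ v ≤? n) ×-dec (n ∸ ℓ + 1 ≤? proj₂ v))))) S

colSize : ℕ → ℕ → ℕ → List Vertex → ℕ
colSize ℓ n a S = length (column ℓ n a S)

module Submission where

-- Put ℓ = 5k and b = n - ℓ + 1, the lowest row of T^ℓ(n).  Because
-- j + 2 ≤ b, the ℓ × 3 rectangle of cells (j + c , b + i), c ≤ 2, i < ℓ, lies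
-- entirely inside T^ℓ(n); within it any two cells at grid distance 1 or 2 are
-- joined by a walk of that length, so a packing set occupies no two of them.
-- Recording the occupied cells of each of the three columns as a Boolean list
-- (a column pattern) turns this into local constraints on patterns: cells in one
-- column are at least three rows apart, cells in neighbouring columns at least
-- two rows apart, and the outer columns share no row.  Every member of S^ℓ_a(n)
-- is an occupied cell, so |S^ℓ_a(n)| is at most the number of marks of column a.

open import Defs
open import Data.Nat using (ℕ; zero; suc; _+_; _*_; _∸_; _≤_; _<_; z≤n; s≤s; _≟_; ∣_-_∣)
open import Data.Nat.Properties
  using (_≤?_; ≤-refl; ≤-reflexive; ≤-pred; m<n⇒m<1+n; ≤-trans; <-irrefl; <⇒≱; n<1+n; m≤m+n; m≤n+m; m≤n⇒m≤1+n;
         +-comm; +-assoc; +-suc; +-identityʳ; +-monoʳ-≤; +-monoˡ-≤; +-cancelʳ-<;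
         m+[n∸m]≡n; m∸n+n≡m; +-∸-assoc; ∸-monoʳ-≤; ∣n-n∣≡0; ∣-∣-comm; module ≤-Reasoning)
open import Data.Bool using (Bool; true; false; _∧_; _∨_; not; T; T?)
open import Data.Bool.Properties using (T-∧; T-≡)
open import Data.Bool.ListAction using (all)
open import Data.Unit using (tt)
open import Data.Empty using (⊥; ⊥-elim)
open import Data.Sum using (_⊎_; inj₁; inj₂)
open import Data.Product using (_×_; _,_; proj₁; proj₂)
open import Data.Product.Properties using (≡-dec)
open import Data.List using (List; []; _∷_; [_]; _++_; map; length; drop; filter; filterᵇ; applyUpTo)
open import Data.List.Properties using (length-applyUpTo; length-++-sucʳ)
open import Data.List.Membership.Propositional using (_∈_)
open import Data.List.Membership.Propositional.Properties
  using (∈-++⁺ˡ; ∈-++⁺ʳ; ∈-++⁻; ∈-map⁺; ∈-filter⁺; ∈-filter⁻; ∈-applyUpTo⁺; ∈-∃++)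
open import Data.List.Relation.Unary.All as All using ()
open import Data.List.Relation.Unary.All.Properties using (all⁺)
open import Data.List.Relation.Unary.Any using (here; there)
open import Data.List.Relation.Unary.AllPairs using ([]; _∷_)
open import Data.List.Relation.Unary.Unique.Propositional using (Unique)
open import Data.List.Relation.Unary.Unique.Propositional.Properties as UniqueProperties using ()
open import Function using (_∘_)
open import Function.Bundles using (Equivalence)
open import Relation.Nullary.Decidable using (Dec; yes; does; _×-dec_; _→-dec_)
open import Relation.Unary using (Decidable)
open import Relation.Binary.PropositionalEquality using (_≡_; _≢_; refl; sym; trans; cong; cong₂; subst; subst₂; module ≡-Reasoning)
open import Data.List.Membership.DecPropositional (≡-dec _≟_ _≟_) using (_∈?_)

-- A column pattern lists, from the bottom row up, whether each cell is occupied;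
-- `marks` counts the occupied cells.
marks : List Bool → ℕ
marks []          = 0
marks (true ∷ v)  = suc (marks v)
marks (false ∷ v) = marks v

-- Entry d of a pattern; cells above the column count as unoccupied.
at : List Bool → ℕ → Bool
at []      _       = false
at (x ∷ _) zero    = x
at (_ ∷ v) (suc d) = at v d

-- `sep d v w`: no row i is occupied in v while row i + d is occupied in w.
sep : ℕ → List Bool → List Bool → Bool
sep d []      _ = true
sep d (x ∷ v) w = not (x ∧ at w d) ∧ sep d v (drop 1 w)

colOK : List Bool → Bool
colOK v = sep 1 v v ∧ sep 2 v v

adjOK : List Bool → List Bool → Bool
adjOK v w = sep 0 v w ∧ sep 1 v w ∧ sep 1 w v

record Admissible (h : ℕ) (u v w : List Bool) : Set where
  field
    length-u : length u ≡ h
    length-v : length v ≡ h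
    length-w : length w ≡ h
    sparse-u : T (colOK u)
    sparse-v : T (colOK v)
    sparse-w : T (colOK w)
    near-uv  : T (adjOK u v)
    near-vw  : T (adjOK v w)
    outer-uw : T (sep 0 u w)

nand-intro : ∀ {x y} → (T x → T y → ⊥) → T (not (x ∧ y))
nand-intro {true}  {true}  both = both tt tt
nand-intro {true}  {false} _    = tt
nand-intro {false}         _    = tt

at-applyUpTo : ∀ (g : ℕ → Bool) m d → T (at (applyUpTo g m) d) → d < m × T (g d)
at-applyUpTo g (suc m) zero    gd = s≤s z≤n , gd
at-applyUpTo g (suc m) (suc d) gd with at-applyUpTo (g ∘ suc) m d gd
... | d<m , gd′ = s≤s d<m , gd′

sep-applyUpTo : ∀ d m (g g′ : ℕ → Bool) →
  (∀ i → d + i < m → T (g i) → T (g′ (d + i)) → ⊥) →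
  T (sep d (applyUpTo g m) (applyUpTo g′ m))
sep-applyUpTo d zero    g g′ apart = tt
sep-applyUpTo d (suc m) g g′ apart =
  Equivalence.from T-∧ (nand-intro bottom-row , sep-applyUpTo d m (g ∘ suc) (g′ ∘ suc) higher-rows)
  where
  d+0≡d : d + 0 ≡ d
  d+0≡d = +-identityʳ d

  bottom-row : T (g 0) → T (at (applyUpTo g′ (suc m)) d) → ⊥
  bottom-row g0 atd with at-applyUpTo g′ (suc m) d atd
  ... | d<1+m , g′d =
    apart 0 (subst (_< suc m) (sym d+0≡d) d<1+m) g0 (subst (T ∘ g′) (sym d+0≡d) g′d)

  higher-rows : ∀ i → d + i < m → T (g (suc i)) → T (g′ (suc (d + i))) → ⊥
  higher-rows i lt gi g′i =
    apart (suc i) (subst (_< suc m) (sym (+-suc d i)) (s≤s lt)) gi (subst (T ∘ g′) (sym (+-suc d i)) g′i)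

allPatterns : ℕ → List (List Bool)
allPatterns zero    = [ [] ]
allPatterns (suc h) = map (true ∷_) (allPatterns h) ++ map (false ∷_) (allPatterns h)

∈-allPatterns : ∀ v → v ∈ allPatterns (length v)
∈-allPatterns []          = here refl
∈-allPatterns (true ∷ v)  = ∈-++⁺ˡ (∈-map⁺ (true ∷_) (∈-allPatterns v))
∈-allPatterns (false ∷ v) = ∈-++⁺ʳ (map (true ∷_) (allPatterns (length v))) (∈-map⁺ (false ∷_) (∈-allPatterns v))

columns : ℕ → List (List Bool)
columns h = filterᵇ colOK (allPatterns h)

∈-columns : ∀ {h} v → length v ≡ h → T (colOK v) → v ∈ columns h
∈-columns v refl ok = ∈-filter⁺ (T? ∘ colOK) (∈-allPatterns v) ok

-- The conclusion of Proposition 3.6 in monotone form: if two of three columns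
-- reach k, the remaining one does not exceed k.
Balanced : ℕ → ℕ → ℕ → ℕ → Set
Balanced k a b c = (k ≤ a → k ≤ b → c ≤ k) × (k ≤ a → k ≤ c → b ≤ k) × (k ≤ b → k ≤ c → a ≤ k)

balanced? : ∀ k a b c → Dec (Balanced k a b c)
balanced? k a b c =
  ((k ≤? a) →-dec (k ≤? b) →-dec (c ≤? k)) ×-dec
  ((k ≤? a) →-dec (k ≤? c) →-dec (b ≤? k)) ×-dec
  ((k ≤? b) →-dec (k ≤? c) →-dec (a ≤? k))

balanced-mono : ∀ {k a b c a′ b′ c′} → a ≤ a′ → b ≤ b′ → c ≤ c′ →
  Balanced k a′ b′ c′ → Balanced k a b c
balanced-mono a≤ b≤ c≤ (ab⇒c , ac⇒b , bc⇒a) =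
  (λ ka kb → ≤-trans c≤ (ab⇒c (≤-trans ka a≤) (≤-trans kb b≤))) ,
  (λ ka kc → ≤-trans b≤ (ac⇒b (≤-trans ka a≤) (≤-trans kc c≤))) ,
  (λ kb kc → ≤-trans a≤ (bc⇒a (≤-trans kb b≤) (≤-trans kc c≤)))

checkThird : ℕ → List Bool → List Bool → List (List Bool) → Bool
checkThird k u v cs =
  all (λ w → not (adjOK v w ∧ sep 0 u w) ∨ does (balanced? k (marks u) (marks v) (marks w))) cs

checkTriples : ℕ → List (List Bool) → Bool
checkTriples k cs = all (λ u → all (λ v → not (adjOK u v) ∨ checkThird k u v cs) cs) cs

does-sound : ∀ {A : Set} (a? : Dec A) → T (does a?) → A
does-sound (yes a) _ = a

modus-ponens : ∀ {x y} → T (not x ∨ y) → T x → T y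
modus-ponens {true} y _ = y

checkTriples-sound : ∀ {k cs u v w} → T (checkTriples k cs) → u ∈ cs → v ∈ cs → w ∈ cs →
  T (adjOK u v) → T (adjOK v w) → T (sep 0 u w) → Balanced k (marks u) (marks v) (marks w)
checkTriples-sound {k} {cs} {u} {v} {w} ok u∈ v∈ w∈ uv vw uw =
  does-sound (balanced? k (marks u) (marks v) (marks w))
    (modus-ponens (All.lookup (all⁺ _ _ third-ok) w∈) (Equivalence.from T-∧ (vw , uw)))
  where
  third-ok : T (checkThird k u v cs)
  third-ok = modus-ponens (All.lookup (all⁺ _ _ (All.lookup (all⁺ _ _ ok) u∈)) v∈) uv

admissible-balanced : ∀ {h k u v w} → checkTriples k (columns h) ≡ true →
  Admissible h u v w → Balanced k (marks u) (marks v) (marks w)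
admissible-balanced {u = u} {v} {w} checked adm =
  checkTriples-sound (Equivalence.from T-≡ checked)
    (∈-columns u length-u sparse-u) (∈-columns v length-v sparse-v) (∈-columns w length-w sparse-w)
    near-uv near-vw outer-uw
  where open Admissible adm

checked-5-1 : checkTriples 1 (columns 5) ≡ true
checked-5-1 = refl

checked-10-2 : checkTriples 2 (columns 10) ≡ true
checked-10-2 = refl

unique-⊆-length : ∀ {A : Set} {xs ys : List A} → Unique xs → (∀ {x} → x ∈ xs → x ∈ ys) →
  length xs ≤ length ys
unique-⊆-length [] _ = z≤n
unique-⊆-length {xs = x ∷ xs} (x∉xs ∷ unique-xs) xs⊆ys with ∈-∃++ (xs⊆ys (here refl))
... | us , vs , refl =
  subst (suc (length xs) ≤_) (sym (length-++-sucʳ us x vs)) (s≤s (unique-⊆-length unique-xs xs⊆us++vs))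
  where
  xs⊆us++vs : ∀ {y} → y ∈ xs → y ∈ us ++ vs
  xs⊆us++vs y∈xs with ∈-++⁻ us (xs⊆ys (there y∈xs))
  ... | inj₁ y∈us          = ∈-++⁺ˡ y∈us
  ... | inj₂ (here refl)   = ⊥-elim (All.lookup x∉xs y∈xs refl)
  ... | inj₂ (there y∈vs)  = ∈-++⁺ʳ us y∈vs

length-filter-applyUpTo : ∀ {A : Set} {P : A → Set} (P? : Decidable P) (f : ℕ → A) m →
  length (filter P? (applyUpTo f m)) ≡ marks (applyUpTo (λ i → does (P? (f i))) m)
length-filter-applyUpTo P? f zero = refl
length-filter-applyUpTo P? f (suc m) with does (P? (f 0))
... | true  = cong suc (length-filter-applyUpTo P? (f ∘ suc) m)
... | false = length-filter-applyUpTo P? (f ∘ suc) m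

∣n-1+n∣≡1 : ∀ y → ∣ y - suc y ∣ ≡ 1
∣n-1+n∣≡1 zero    = refl
∣n-1+n∣≡1 (suc y) = ∣n-1+n∣≡1 y

adj-up : ∀ x y → GridAdj (x , y) (x , suc y)
adj-up x y = cong₂ _+_ (∣n-n∣≡0 x) (∣n-1+n∣≡1 y)

adj-down : ∀ x y → GridAdj (x , suc y) (x , y)
adj-down x y = cong₂ _+_ (∣n-n∣≡0 x) (trans (∣-∣-comm (suc y) y) (∣n-1+n∣≡1 y))

adj-right : ∀ x y → GridAdj (x , y) (suc x , y)
adj-right x y = cong₂ _+_ (∣n-1+n∣≡1 x) (∣n-n∣≡0 y)

rows-differ : ∀ {x x′ y y′ : ℕ} → y < y′ → (x , y) ≢ (x′ , y′)
rows-differ y<y′ refl = <-irrefl refl y<y′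

cols-differ : ∀ {x x′ y y′ : ℕ} → x < x′ → (x , y) ≢ (x′ , y′)
cols-differ x<x′ refl = <-irrefl refl x<x′

module Band (ℓ n : ℕ) (S : List Vertex) (ℓ≤n : ℓ ≤ n) where

  bottom : ℕ
  bottom = n ∸ ℓ + 1

  band-top : ℓ + bottom ≡ suc n
  band-top = begin
    ℓ + (n ∸ ℓ + 1)  ≡⟨ +-assoc ℓ (n ∸ ℓ) 1 ⟨
    ℓ + (n ∸ ℓ) + 1  ≡⟨ cong (_+ 1) (m+[n∸m]≡n ℓ≤n) ⟩
    n + 1            ≡⟨ +-comm n 1 ⟩
    suc n            ∎
    where open ≡-Reasoning

  row-in-band : ∀ {i} → i < ℓ → i + bottom ≤ n
  row-in-band {i} i<ℓ = ≤-pred (subst (suc (i + bottom) ≤_) band-top (+-monoˡ-≤ bottom i<ℓ))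

  band-row : ∀ {y} → bottom ≤ y → y ≤ n → y ∸ bottom < ℓ
  band-row {y} b≤y y≤n =
    +-cancelʳ-< bottom (y ∸ bottom) ℓ (subst₂ _<_ (sym (m∸n+n≡m b≤y)) (sym band-top) (s≤s y≤n))

  occupied : Vertex → Bool
  occupied u = does (u ∈? S)

  colPattern : ℕ → List Bool
  colPattern a = applyUpTo (λ i → occupied (a , i + bottom)) ℓ

  colSize-bound : Unique S → ∀ a → colSize ℓ n a S ≤ marks (colPattern a)
  colSize-bound unique-S a =
    subst (colSize ℓ n a S ≤_) (length-filter-applyUpTo (_∈? S) cell ℓ)
      (unique-⊆-length (UniqueProperties.filter⁺ _ unique-S) column⊆occupied-cells)
    where
    cell : ℕ → Vertex
    cell i = (a , i + bottom)

    occupied-cells : List Vertex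
    occupied-cells = filter (_∈? S) (applyUpTo cell ℓ)

    -- A member (a, y) of S^ℓ_a(n) is the cell of row y - bottom.
    column⊆occupied-cells : ∀ {u} → u ∈ column ℓ n a S → u ∈ occupied-cells
    column⊆occupied-cells {x , y} u∈ with ∈-filter⁻ _ {xs = S} u∈
    ... | u∈S , (refl , _ , _ , y≤n , b≤y) =
      subst (_∈ occupied-cells) (cong (x ,_) row≡y)
        (∈-filter⁺ (_∈? S) (∈-applyUpTo⁺ cell (band-row b≤y y≤n)) (subst (_∈ S) (cong (x ,_) (sym row≡y)) u∈S))
      where
      row≡y : y ∸ bottom + bottom ≡ y
      row≡y = m∸n+n≡m b≤y

  module ThreeColumns (packing : IsPackingSet ℓ n S) (j : ℕ) (1≤j : 1 ≤ j) (fits : 2 + j ≤ bottom) where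

    cell : ℕ → ℕ → Vertex
    cell c i = (c + j , i + bottom)

    col : ℕ → List Bool
    col c = colPattern (c + j)

    cell-in-band : ∀ {c i} → c ≤ 2 → i < ℓ → InTl ℓ n (cell c i)
    cell-in-band {c} {i} c≤2 i<ℓ =
      ≤-trans 1≤j (m≤n+m j c) ,
      ≤-trans (+-monoˡ-≤ j c≤2) (≤-trans fits (m≤n+m bottom i)) ,
      row-in-band i<ℓ ,
      m≤n+m bottom i

    far-apart : ∀ {k u v} → u ≢ v → Walk ℓ n k u v → k ≤ 2 → T (occupied u) → T (occupied v) → ⊥
    far-apart u≢v walk k≤2 occ-u occ-v =
      <⇒≱ (s≤s k≤2)
        (proj₂ (proj₂ packing) (does-sound (_ ∈? S) occ-u) (does-sound (_ ∈? S) occ-v) u≢v _ walk)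

    stay : ∀ {c i} → c ≤ 2 → i < ℓ → Walk ℓ n 0 (cell c i) (cell c i)
    stay c≤2 i<ℓ = here (cell-in-band c≤2 i<ℓ)

    up : ∀ {k c i v} → c ≤ 2 → i < ℓ → Walk ℓ n k (cell c (suc i)) v → Walk ℓ n (suc k) (cell c i) v
    up {c = c} {i} c≤2 i<ℓ = step (cell-in-band c≤2 i<ℓ) (adj-up (c + j) (i + bottom))

    down : ∀ {k c i v} → c ≤ 2 → suc i < ℓ → Walk ℓ n k (cell c i) v → Walk ℓ n (suc k) (cell c (suc i)) v
    down {c = c} {i} c≤2 1+i<ℓ = step (cell-in-band c≤2 1+i<ℓ) (adj-down (c + j) (i + bottom))

    right : ∀ {k c i v} → c ≤ 2 → i < ℓ → Walk ℓ n k (cell (suc c) i) v → Walk ℓ n (suc k) (cell c i) v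
    right {c = c} {i} c≤2 i<ℓ = step (cell-in-band c≤2 i<ℓ) (adj-right (c + j) (i + bottom))

    lower : ∀ d {i} → d + i < ℓ → i < ℓ
    lower d {i} lt = ≤-trans (s≤s (m≤n+m i d)) lt

    column-sparse : ∀ {c} → c ≤ 2 → T (colOK (col c))
    column-sparse {c} c≤2 =
      Equivalence.from T-∧ (sep-applyUpTo 1 ℓ _ _ one-apart , sep-applyUpTo 2 ℓ _ _ two-apart)
      where
      one-apart : ∀ i → 1 + i < ℓ → T (occupied (cell c i)) → T (occupied (cell c (1 + i))) → ⊥
      one-apart i lt = far-apart (rows-differ (n<1+n _)) (up c≤2 (lower 1 lt) (stay c≤2 lt)) (s≤s z≤n)

      two-apart : ∀ i → 2 + i < ℓ → T (occupied (cell c i)) → T (occupied (cell c (2 + i))) → ⊥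
      two-apart i lt =
        far-apart (rows-differ (m<n⇒m<1+n (n<1+n _)))
          (up c≤2 (lower 2 lt) (up c≤2 (lower 1 lt) (stay c≤2 lt))) (s≤s (s≤s z≤n))

    adjacent-sparse : ∀ {c} → c ≤ 1 → T (adjOK (col c) (col (suc c)))
    adjacent-sparse {c} c≤1 =
      Equivalence.from T-∧ (sep-applyUpTo 0 ℓ _ _ beside ,
        Equivalence.from T-∧ (sep-applyUpTo 1 ℓ _ _ diagonal-up , sep-applyUpTo 1 ℓ _ _ diagonal-down))
      where
      c≤2 : c ≤ 2
      c≤2 = m≤n⇒m≤1+n c≤1

      1+c≤2 : suc c ≤ 2
      1+c≤2 = s≤s c≤1

      beside : ∀ i → 0 + i < ℓ → T (occupied (cell c i)) → T (occupied (cell (suc c) i)) → ⊥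
      beside i lt = far-apart (cols-differ (n<1+n _)) (right c≤2 lt (stay 1+c≤2 lt)) (s≤s z≤n)

      diagonal-up : ∀ i → 1 + i < ℓ → T (occupied (cell c i)) → T (occupied (cell (suc c) (1 + i))) → ⊥
      diagonal-up i lt =
        far-apart (cols-differ (n<1+n _))
          (right c≤2 (lower 1 lt) (up 1+c≤2 (lower 1 lt) (stay 1+c≤2 lt))) (s≤s (s≤s z≤n))

      diagonal-down : ∀ i → 1 + i < ℓ → T (occupied (cell (suc c) i)) → T (occupied (cell c (1 + i))) → ⊥
      diagonal-down i lt occ-right occ-left =
        far-apart (cols-differ (n<1+n _))
          (right c≤2 lt (down 1+c≤2 lt (stay 1+c≤2 (lower 1 lt)))) (s≤s (s≤s z≤n)) occ-left occ-right

    outer-sparse : T (sep 0 (col 0) (col 2))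
    outer-sparse = sep-applyUpTo 0 ℓ _ _ two-right
      where
      two-right : ∀ i → 0 + i < ℓ → T (occupied (cell 0 i)) → T (occupied (cell 2 i)) → ⊥
      two-right i lt =
        far-apart (cols-differ (m<n⇒m<1+n (n<1+n _)))
          (right z≤n lt (right (s≤s z≤n) lt (stay ≤-refl lt))) (s≤s (s≤s z≤n))

    admissible : Admissible ℓ (col 0) (col 1) (col 2)
    admissible = record
      { length-u = length-applyUpTo _ ℓ
      ; length-v = length-applyUpTo _ ℓ
      ; length-w = length-applyUpTo _ ℓ
      ; sparse-u = column-sparse z≤n
      ; sparse-v = column-sparse (s≤s z≤n)
      ; sparse-w = column-sparse ≤-refl
      ; near-uv  = adjacent-sparse z≤n
      ; near-vw  = adjacent-sparse ≤-refl
      ; outer-uw = outer-sparse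
      }

    three-columns-balanced : ∀ {k} → checkTriples k (columns ℓ) ≡ true →
      Balanced k (colSize ℓ n j S) (colSize ℓ n (j + 1) S) (colSize ℓ n (j + 2) S)
    three-columns-balanced checked =
      balanced-mono (colSize-bound unique-S j) (shifted-bound 1) (shifted-bound 2)
        (admissible-balanced checked admissible)
      where
      unique-S : Unique S
      unique-S = proj₁ packing

      shifted-bound : ∀ c → colSize ℓ n (j + c) S ≤ marks (col c)
      shifted-bound c = subst (λ a → colSize ℓ n a S ≤ marks (col c)) (+-comm c j) (colSize-bound unique-S (c + j))

fits-in-band : ∀ {n j ℓ} → ℓ ≤ 10 → 12 ≤ n → j ≤ n ∸ 12 → 2 + j ≤ n ∸ ℓ + 1
fits-in-band {n} {j} {ℓ} ℓ≤10 12≤n j≤n∸12 = begin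
  2 + j         ≤⟨ +-monoʳ-≤ 2 j≤n∸12 ⟩
  2 + (n ∸ 12)  ≡⟨ +-∸-assoc 2 12≤n ⟨
  n ∸ 10        ≤⟨ ∸-monoʳ-≤ n ℓ≤10 ⟩
  n ∸ ℓ         ≤⟨ m≤m+n (n ∸ ℓ) 1 ⟩
  n ∸ ℓ + 1     ∎
  where open ≤-Reasoning

three-columns : ∀ {n j ℓ k S} → ℓ ≤ 10 → 27 ≤ n → 1 ≤ j → j ≤ n ∸ 12 → IsPackingSet ℓ n S →
  checkTriples k (columns ℓ) ≡ true →
  Balanced k (colSize ℓ n j S) (colSize ℓ n (j + 1) S) (colSize ℓ n (j + 2) S)
three-columns {n} {j} {ℓ} {S = S} ℓ≤10 27≤n 1≤j j≤n∸12 packing =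
  ThreeColumns.three-columns-balanced packing j 1≤j (fits-in-band ℓ≤10 (≤-trans (m≤m+n 12 15) 27≤n) j≤n∸12)
  where
  open Band ℓ n S (≤-trans ℓ≤10 (≤-trans (m≤m+n 10 17) 27≤n))

two-force-third : ∀ {k a b c} → Balanced k a b c →
  (a ≡ k × b ≡ k → c ≤ k) × (a ≡ k × c ≡ k → b ≤ k) × (b ≡ k × c ≡ k → a ≤ k)
two-force-third (ab⇒c , ac⇒b , bc⇒a) =
  (λ { (a≡k , b≡k) → ab⇒c (reach a≡k) (reach b≡k) }) ,
  (λ { (a≡k , c≡k) → ac⇒b (reach a≡k) (reach c≡k) }) ,
  (λ { (b≡k , c≡k) → bc⇒a (reach b≡k) (reach c≡k) })
  where
  reach : ∀ {k x} → x ≡ k → k ≤ x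
  reach x≡k = ≤-reflexive (sym x≡k)

proposition3p6 : (n j k : ℕ) → 27 ≤ n → 1 ≤ j → j ≤ n ∸ 12 → (k ≡ 1 ⊎ k ≡ 2) →
    (S : List Vertex) → IsPackingSet (5 * k) n S →
    ((colSize (5 * k) n j S ≡ k × colSize (5 * k) n (j + 1) S ≡ k → colSize (5 * k) n (j + 2) S ≤ k)
    × (colSize (5 * k) n j S ≡ k × colSize (5 * k) n (j + 2) S ≡ k → colSize (5 * k) n (j + 1) S ≤ k)
    × (colSize (5 * k) n (j + 1) S ≡ k × colSize (5 * k) n (j + 2) S ≡ k → colSize (5 * k) n j S ≤ k))
proposition3p6 n j .1 27≤n 1≤j j≤n∸12 (inj₁ refl) S packing =
  two-force-third (three-columns (m≤m+n 5 5) 27≤n 1≤j j≤n∸12 packing checked-5-1)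
proposition3p6 n j .2 27≤n 1≤j j≤n∸12 (inj₂ refl) S packing =
  two-force-third (three-columns ≤-refl 27≤n 1≤j j≤n∸12 packing checked-10-2)
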